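{- Let $T$ be an out-branching of a digraph $D$ and let $Q$ be a dipath in $D$ that starts at the root $r$ of $T$. Then performing the 1-changes for all arcs in $A(Q)\setminus A(T)$ yields again an out-branching of $D$, and this out-branching contains $Q$.
   Context: An out-tree of a digraph $D$ is a subdigraph whose underlying undirected graph is a tree and which has exactly one vertex of in-degree zero (its root), all others in-degree one; an out-branching is a spanning out-tree. A dipath is a digraph with distinct vertices $v_1,\dots,v_s$ and arcs $(v_i,v_{i+1})$. For an out-branching $T$ and an arc $(u,v)\in A(D)\setminus A(T)$ with $v$ not the root, the 1-change for $(u,v)$ replaces $T$ by $T+(u,v)-(w,v)$, where $w$ is the unique in-neighbor of $v$ in $T$. -}

module Defs where

open import Data.Nat using (ℕ; zero; suc; _≤_)
open import Data.Bool using (Bool; true; false; if_then_else_; not; _∧_)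
open import Data.Fin using (Fin; _≟_)
open import Data.Product using (_×_; _,_; Σ; ∃)
open import Data.Sum using (_⊎_)
open import Data.List using (List; []; _∷_; _++_; [_]; length; foldl; filterᵇ; map; allFin)
open import Data.Nat.ListAction using (sum)
open import Data.Empty using (⊥)
open import Data.List.Relation.Unary.All using (All)
open import Data.List.Relation.Unary.Unique.Propositional using (Unique)
open import Relation.Binary.PropositionalEquality using (_≡_; _≢_)
open import Relation.Nullary using (¬_)
open import Relation.Nullary.Decidable using (⌊_⌋)

-- Arc sets of (spanning sub)digraphs on vertex set Fin n,
-- as decidable relations: (u , v) is an arc iff A u v ≡ true.
Arcs : ℕ → Set
Arcs n = Fin n → Fin n → Bool

Arc : ∀ {n} → Arcs n → Fin n → Fin n → Set
Arc A u v = A u v ≡ true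

-- A digraph (standard convention: no loops; no parallel arcs by representation).
record Digraph (n : ℕ) : Set where
  field
    arcs     : Arcs n
    loopless : ∀ v → arcs v v ≡ false
open Digraph public

_⊆A_ : ∀ {n} → Arcs n → Arcs n → Set
T ⊆A A = ∀ u v → Arc T u v → Arc A u v

indeg : ∀ {n} → Arcs n → Fin n → ℕ
indeg {n} T v = sum (map (λ u → if T u v then 1 else 0) (allFin n))

Adj : ∀ {n} → Arcs n → Fin n → Fin n → Set
Adj T u v = Arc T u v ⊎ Arc T v u

pairs : ∀ {n} → List (Fin n) → List (Fin n × Fin n)
pairs []           = []
pairs (x ∷ [])     = []
pairs (x ∷ y ∷ xs) = (x , y) ∷ pairs (y ∷ xs)

data UWalk {n} (T : Arcs n) : Fin n → Fin n → Set where
  here : ∀ {u} → UWalk T u u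
  step : ∀ {u w v} → Adj T u w → UWalk T w v → UWalk T u v

UConnected : ∀ {n} → Arcs n → Set
UConnected T = ∀ u v → UWalk T u v

UCycle : ∀ {n} → Arcs n → List (Fin n) → Set
UCycle T [] = ⊥
UCycle T (x ∷ xs) =
  Unique (x ∷ xs) × 2 ≤ length xs ×
  All (λ p → Adj T (Data.Product.proj₁ p) (Data.Product.proj₂ p)) (pairs ((x ∷ xs) ++ [ x ]))

UAcyclic : ∀ {n} → Arcs n → Set
UAcyclic T = ∀ c → ¬ UCycle T c

UTree : ∀ {n} → Arcs n → Set
UTree T = UConnected T × UAcyclic T

OutBranchingAt : ∀ {n} → Digraph n → Arcs n → Fin n → Set
OutBranchingAt D T r =
  T ⊆A arcs D × UTree T × indeg T r ≡ 0 × (∀ v → v ≢ r → indeg T v ≡ 1)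

IsOutBranching : ∀ {n} → Digraph n → Arcs n → Set
IsOutBranching D T = ∃ λ r → OutBranchingAt D T r

IsDipath : ∀ {n} → Digraph n → List (Fin n) → Set
IsDipath D Q = Unique Q × All (λ p → Arc (arcs D) (Data.Product.proj₁ p) (Data.Product.proj₂ p)) (pairs Q)

PathIn : ∀ {n} → List (Fin n) → Arcs n → Set
PathIn Q T = All (λ p → Arc T (Data.Product.proj₁ p) (Data.Product.proj₂ p)) (pairs Q)

-- 1-change for arc (u , v): T + (u,v) - (w,v), where w is the unique
-- in-neighbour of v in T; i.e. the in-arcs of v are replaced by (u , v).
oneChange : ∀ {n} → Arcs n → Fin n × Fin n → Arcs n
oneChange T (u , v) a b = if ⌊ b ≟ v ⌋ then ⌊ a ≟ u ⌋ else T a b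

changesAlong : ∀ {n} → Arcs n → List (Fin n) → Arcs n
changesAlong T Q =
  foldl oneChange T (filterᵇ (λ p → not (T (Data.Product.proj₁ p) (Data.Product.proj₂ p))) (pairs Q))

-- An out-branching rooted at r is the same thing as an arborescence: r has no
-- in-arc, every vertex has at most one in-neighbour, and every vertex is
-- reachable from r.  Such a graph is a tree: depths from r grow along arcs,
-- and going around an undirected cycle some vertex would have to be entered
-- twice.  The 1-changes along Q make each vertex of Q the child of its
-- predecessor on Q and leave every other in-arc alone; r is not a later vertex
-- of Q, so it stays a source.  A vertex off Q keeps its parent and a vertex on
-- Q is reached along Q, so the result is again an arborescence, containing Q.
module Submission where

open import Defs
open import Data.Nat using (ℕ; suc; _<_; s≤s)
open import Data.Nat.Properties using (suc-injective; n<1+n; <-trans; <-irrefl)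
open import Data.Bool using (Bool; true; false; if_then_else_; not)
open import Data.Bool.Properties using (not-¬; ¬-not)
open import Data.Fin using (Fin; _≟_)
open import Data.Product using (_×_; _,_; ∃-syntax; proj₁; proj₂; map₂)
open import Data.Sum using (inj₁; inj₂)
open import Data.Unit using (⊤; tt)
open import Data.List using (List; []; _∷_; _++_; [_]; map; allFin; foldl; filterᵇ)
open import Data.Nat.ListAction using (sum)
open import Data.List.Relation.Unary.All using (All; []; _∷_)
import Data.List.Relation.Unary.All as All
import Data.List.Relation.Unary.All.Properties as All
open import Data.List.Relation.Unary.Any using (here; there; any?)
open import Data.List.Relation.Unary.AllPairs using (AllPairs; []; _∷_)
import Data.List.Relation.Unary.AllPairs.Properties as AllPairs
open import Data.List.Relation.Unary.Unique.Propositional using (Unique)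
open import Data.List.Relation.Unary.Unique.Propositional.Properties using (allFin⁺)
open import Data.List.Membership.Propositional using (_∈_; _∉_)
open import Data.List.Membership.Propositional.Properties using (∈-allFin)
open import Function.Bundles using (_⇔_; mk⇔; Equivalence)
open import Relation.Binary.PropositionalEquality
  using (_≡_; _≢_; refl; sym; trans; cong; subst; ≢-sym)
open import Relation.Nullary using (¬_; yes; no; contradiction)
open import Relation.Nullary.Decidable using (⌊_⌋)

module _ {A : Set} (f : A → Bool) where

  count : List A → ℕ
  count xs = sum (map (λ x → if f x then 1 else 0) xs)

  count≡0 : ∀ xs → All (λ x → f x ≡ false) xs → count xs ≡ 0
  count≡0 []       []         = refl
  count≡0 (_ ∷ xs) (fx ∷ fxs) rewrite fx = count≡0 xs fxs

  count≡0⇒false : ∀ xs {x} → count xs ≡ 0 → x ∈ xs → f x ≡ false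
  count≡0⇒false (y ∷ _) e (here refl) with f y | e
  ... | false | _ = refl
  count≡0⇒false (y ∷ xs) e (there x∈) with f y | e
  ... | false | e′ = count≡0⇒false xs e′ x∈

  count-tail : ∀ {x} xs → f x ≡ true → count (x ∷ xs) ≡ 1 → count xs ≡ 0
  count-tail _ fx e rewrite fx = suc-injective e

  count≢0 : ∀ xs {x} → x ∈ xs → f x ≡ true → count xs ≢ 0
  count≢0 xs x∈ fx e = contradiction (trans (sym fx) (count≡0⇒false xs e x∈)) λ ()

  count≡1 : ∀ {xs x} → Unique xs → x ∈ xs → f x ≡ true → (∀ y → f y ≡ true → y ≡ x) →
            count xs ≡ 1
  count≡1 (y∉ ∷ _) (here refl) fx only rewrite fx =
    cong suc (count≡0 _ (All.map (λ y≢z → ¬-not (λ fz → y≢z (sym (only _ fz)))) y∉))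
  count≡1 {y ∷ _} (y∉ ∷ u) (there x∈) fx only
    rewrite ¬-not (λ fy → All.lookup y∉ x∈ (only y fy)) = count≡1 u x∈ fx only

  count≡1⇒≡ : ∀ xs {x y} → count xs ≡ 1 → x ∈ xs → y ∈ xs → f x ≡ true → f y ≡ true → x ≡ y
  count≡1⇒≡ _ e (here refl) (here refl) _ _ = refl
  count≡1⇒≡ (_ ∷ xs) e (here refl) (there y∈) fz fy = contradiction (count-tail xs fz e) (count≢0 xs y∈ fy)
  count≡1⇒≡ (_ ∷ xs) e (there x∈) (here refl) fx fz = contradiction (count-tail xs fz e) (count≢0 xs x∈ fx)
  count≡1⇒≡ (z ∷ xs) e (there x∈) (there y∈) fx fy with f z | e
  ... | false | e′ = count≡1⇒≡ xs e′ x∈ y∈ fx fy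
  ... | true  | e′ = contradiction (suc-injective e′) (count≢0 xs x∈ fx)

NoArcInto : ∀ {n} → Arcs n → Fin n → Set
NoArcInto T v = ∀ a → ¬ Arc T a v

UniqueInNeighbours : ∀ {n} → Arcs n → Set
UniqueInNeighbours T = ∀ {a b v} → Arc T a v → Arc T b v → a ≡ b

module _ {n} (T : Arcs n) (v : Fin n) where

  indeg≡0⇒noArcInto : indeg T v ≡ 0 → NoArcInto T v
  indeg≡0⇒noArcInto d0 a = not-¬ (count≡0⇒false (λ u → T u v) (allFin n) d0 (∈-allFin a))

  noArcInto⇒indeg≡0 : NoArcInto T v → indeg T v ≡ 0
  noArcInto⇒indeg≡0 noIn = count≡0 (λ u → T u v) (allFin n) (All.tabulate λ {a} _ → ¬-not (noIn a))

  indeg≡1⇒≡ : indeg T v ≡ 1 → ∀ {a b} → Arc T a v → Arc T b v → a ≡ b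
  indeg≡1⇒≡ d1 {a} {b} = count≡1⇒≡ (λ u → T u v) (allFin n) d1 (∈-allFin a) (∈-allFin b)

  uniqueIn⇒indeg≡1 : ∀ {u} → Arc T u v → (∀ a → Arc T a v → a ≡ u) → indeg T v ≡ 1
  uniqueIn⇒indeg≡1 {u} = count≡1 (λ a → T a v) (allFin⁺ n) (∈-allFin u)

data Reach {n} (G : Arcs n) (r : Fin n) : Fin n → Set where
  start : Reach G r r
  _▷_   : ∀ {u v} → Reach G r u → Arc G u v → Reach G r v

module _ {n} {G : Arcs n} where

  steps : ∀ {r v} → Reach G r v → ℕ
  steps start   = 0
  steps (R ▷ _) = suc (steps R)

  _++ʷ_ : ∀ {u v w} → UWalk G u v → UWalk G v w → UWalk G u w
  here     ++ʷ W′ = W′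
  step a W ++ʷ W′ = step a (W ++ʷ W′)

  reach⇒walkFrom : ∀ {r v} → Reach G r v → UWalk G r v
  reach⇒walkFrom start    = here
  reach⇒walkFrom (R ▷ uv) = reach⇒walkFrom R ++ʷ step (inj₁ uv) here

  reach⇒walkTo : ∀ {r v} → Reach G r v → UWalk G v r
  reach⇒walkTo start    = here
  reach⇒walkTo (R ▷ uv) = step (inj₂ uv) (reach⇒walkTo R)

  reach-alongPath : ∀ {r x} xs → PathIn (x ∷ xs) G → Reach G r x →
                    ∀ {u v} → (u , v) ∈ pairs (x ∷ xs) → Reach G r v
  reach-alongPath (_ ∷ _)  (xy ∷ _)  R (here refl) = R ▷ xy
  reach-alongPath (_ ∷ ys) (xy ∷ ps) R (there m)   = reach-alongPath ys ps (R ▷ xy) m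

  module _ {r} (noIn : NoArcInto G r) (uniq : UniqueInNeighbours G) where

    steps-unique : ∀ {v} (R R′ : Reach G r v) → steps R ≡ steps R′
    steps-unique start    start      = refl
    steps-unique start    (_ ▷ ar)   = contradiction ar (noIn _)
    steps-unique (_ ▷ ar) start      = contradiction ar (noIn _)
    steps-unique (R ▷ uv) (R′ ▷ u′v) with uniq uv u′v
    ... | refl = cong suc (steps-unique R R′)

    walk⇒reach : ∀ {u v} → Reach G r u → UWalk G u v → Reach G r v
    walk⇒reach R        here                  = R
    walk⇒reach R        (step (inj₁ uw) W)    = walk⇒reach (R ▷ uw) W
    walk⇒reach start    (step (inj₂ wr) W)    = contradiction wr (noIn _)
    walk⇒reach (R ▷ u′u) (step (inj₂ wu) W) with uniq u′u wu
    ... | refl = walk⇒reach R W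

record Arborescence {n} (G : Arcs n) (r : Fin n) : Set where
  field
    noArcIntoRoot : NoArcInto G r
    uniqueIn      : UniqueInNeighbours G
    reachable     : ∀ v → Reach G r v

NonBacktracking : ∀ {A : Set} → List A → Set
NonBacktracking (a ∷ b ∷ c ∷ xs) = a ≢ c × NonBacktracking (b ∷ c ∷ xs)
NonBacktracking _                = ⊤

unique⇒nonBacktracking-snoc : ∀ {A : Set} {xs} {z : A} → Unique xs → All (_≢ z) xs →
                              NonBacktracking (xs ++ [ z ])
unique⇒nonBacktracking-snoc {xs = []}             _                   _           = tt
unique⇒nonBacktracking-snoc {xs = _ ∷ []}         _                   _           = tt
unique⇒nonBacktracking-snoc {xs = _ ∷ _ ∷ []}     _                   (a≢z ∷ _)   = a≢z , tt
unique⇒nonBacktracking-snoc {xs = _ ∷ _ ∷ _ ∷ _}  ((_ ∷ a≢c ∷ _) ∷ u) (_ ∷ ≢z)    =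
  a≢c , unique⇒nonBacktracking-snoc u ≢z

module _ {n} {G : Arcs n} {r : Fin n} (A : Arborescence G r) where
  open Arborescence A

  UChain : List (Fin n) → Set
  UChain xs = All (λ p → Adj G (proj₁ p) (proj₂ p)) (pairs xs)

  depth : Fin n → ℕ
  depth v = steps (reachable v)

  depth-< : ∀ {u v} → Arc G u v → depth u < depth v
  depth-< {u} {v} uv rewrite steps-unique noArcIntoRoot uniqueIn (reachable v) (reachable u ▷ uv) =
    n<1+n (depth u)

  -- The walk continues to a vertex other than p, the only in-neighbour of c, so it leaves c
  -- by an arc: once a non-backtracking walk moves away from the root, it keeps doing so.
  rising : ∀ {p c} rest z → Arc G p c → UChain (c ∷ rest ++ [ z ]) →
           NonBacktracking (p ∷ c ∷ rest ++ [ z ]) →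
           ∃[ w ] w ∈ c ∷ rest × Arc G w z × depth p < depth w
  rising {c = c} []  z pc (inj₁ cz ∷ []) _          = c , here refl , cz , depth-< pc
  rising         []  z pc (inj₂ zc ∷ []) (p≢z , _)  = contradiction (uniqueIn pc zc) p≢z
  rising (d ∷ rest)  z pc (inj₁ cd ∷ ch) (_ , nb) with rising rest z cd ch nb
  ... | w , w∈ , wz , c<w = w , there w∈ , wz , <-trans (depth-< pc) c<w
  rising (d ∷ rest)  z pc (inj₂ dc ∷ ch) (p≢d , _)  = contradiction (uniqueIn pc dc) p≢d

  falling : ∀ {c d} rest z → depth c < depth z → UChain (c ∷ d ∷ rest ++ [ z ]) →
            NonBacktracking (c ∷ d ∷ rest ++ [ z ]) → ∃[ w ] w ∈ d ∷ rest × Arc G w z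
  falling rest z _ (inj₁ cd ∷ ch) nb with rising rest z cd ch nb
  ... | w , w∈ , wz , _ = w , w∈ , wz
  falling {d = d} [] z _ (inj₂ _ ∷ inj₁ dz ∷ []) _ = d , here refl , dz
  falling [] z c<z (inj₂ dc ∷ inj₂ zd ∷ []) _ =
    contradiction (<-trans (depth-< zd) (<-trans (depth-< dc) c<z)) (<-irrefl refl)
  falling (_ ∷ rest) z c<z (inj₂ dc ∷ ch) (_ , nb) with falling rest z (<-trans (depth-< dc) c<z) ch nb
  ... | w , w∈ , wz = w , there w∈ , wz

  -- A cycle leaving x by an arc closes into a directed cycle; one entering x by y → x
  -- walks downhill from y back to x and enters x a second time.
  acyclic : UAcyclic G
  acyclic (_ ∷ [])                 (_ , () , _)
  acyclic (_ ∷ _ ∷ [])             (_ , s≤s () , _)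
  acyclic (x ∷ y ∷ y′ ∷ ys) ((x∉ ∷ y∉ ∷ u) , _ , inj₁ xy ∷ ch)
    with rising (y′ ∷ ys) x xy ch
           (All.lookup x∉ (there (here refl)) , unique⇒nonBacktracking-snoc (y∉ ∷ u) (All.map ≢-sym x∉))
  ... | w , _ , wx , x<w = contradiction (<-trans x<w (depth-< wx)) (<-irrefl refl)
  acyclic (x ∷ y ∷ y′ ∷ ys) ((x∉ ∷ y∉ ∷ u) , _ , inj₂ yx ∷ ch)
    with falling ys x (depth-< yx) ch (unique⇒nonBacktracking-snoc (y∉ ∷ u) (All.map ≢-sym x∉))
  ... | w , w∈ , wx = All.lookup y∉ w∈ (uniqueIn yx wx)

  connected : UConnected G
  connected u v = reach⇒walkTo (reachable u) ++ʷ reach⇒walkFrom (reachable v)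

  arborescence⇒outBranchingAt : ∀ D → G ⊆A arcs D → OutBranchingAt D G r
  arborescence⇒outBranchingAt _ G⊆D =
    G⊆D , (connected , acyclic) , noArcInto⇒indeg≡0 G r noArcIntoRoot , indeg≡1
    where
      indeg≡1 : ∀ v → v ≢ r → indeg G v ≡ 1
      indeg≡1 v v≢r with reachable v
      ... | start  = contradiction refl v≢r
      ... | _ ▷ uv = uniqueIn⇒indeg≡1 G v uv (λ a av → uniqueIn av uv)

outBranchingAt⇒arborescence : ∀ {n} (D : Digraph n) {T r} → OutBranchingAt D T r → Arborescence T r
outBranchingAt⇒arborescence _ {T} {r} (_ , (conn , _) , d0 , d1) = record
  { noArcIntoRoot = noIn
  ; uniqueIn      = uniq
  ; reachable     = λ v → walk⇒reach noIn uniq start (conn r v)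
  }
  where
    noIn : NoArcInto T r
    noIn = indeg≡0⇒noArcInto T r d0

    uniq : UniqueInNeighbours T
    uniq {a} {v = v} av bv with v ≟ r
    ... | yes refl = contradiction av (noIn a)
    ... | no v≢r   = indeg≡1⇒≡ T v (d1 v v≢r) av bv

module _ {n} (T : Arcs n) where

  oneChange-other : ∀ {u v b} a → b ≢ v → oneChange T (u , v) a b ≡ T a b
  oneChange-other {v = v} {b} a b≢v with b ≟ v
  ... | yes b≡v = contradiction b≡v b≢v
  ... | no _    = refl

  oneChange-same : ∀ {u v} a → oneChange T (u , v) a v ≡ ⌊ a ≟ u ⌋
  oneChange-same {v = v} a with v ≟ v
  ... | yes _   = refl
  ... | no v≢v  = contradiction refl v≢v

DistinctHeads : ∀ {A B : Set} → List (A × B) → Set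
DistinctHeads = AllPairs (λ p q → proj₂ p ≢ proj₂ q)

module _ {n} (keep : Fin n × Fin n → Bool) where

  changes-column-untouched : ∀ {v} P (T : Arcs n) → All (λ q → v ≢ proj₂ q) P →
                             ∀ a → foldl oneChange T (filterᵇ keep P) a v ≡ T a v
  changes-column-untouched []      T []         a = refl
  changes-column-untouched (q ∷ P) T (v≢ ∷ v≢s) a with keep q
  ... | true  = trans (changes-column-untouched P (oneChange T q) v≢s a) (oneChange-other T a v≢)
  ... | false = changes-column-untouched P T v≢s a

  changes-column-head : ∀ {u v} P (T : Arcs n) → DistinctHeads P → (u , v) ∈ P →
                        ∀ a → foldl oneChange T (filterᵇ keep P) a v ≡
                              (if keep (u , v) then ⌊ a ≟ u ⌋ else T a v)
  changes-column-head {u} {v} (_ ∷ P) T (v∉ ∷ _) (here refl) a with keep (u , v)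
  ... | true  = trans (changes-column-untouched P (oneChange T (u , v)) v∉ a) (oneChange-same T a)
  ... | false = changes-column-untouched P T v∉ a
  changes-column-head {u} {v} (q ∷ P) T (w∉ ∷ distinct) (there m) a with keep q
  ... | true  = trans (changes-column-head P (oneChange T q) distinct m a)
                      (cong (if keep (u , v) then ⌊ a ≟ u ⌋ else_)
                            (oneChange-other T a (≢-sym (All.lookup w∉ m))))
  ... | false = changes-column-head P T distinct m a

module _ {n : ℕ} where

  heads-pairs : ∀ (x : Fin n) xs → map proj₂ (pairs (x ∷ xs)) ≡ xs
  heads-pairs x []       = refl
  heads-pairs x (y ∷ ys) = cong (y ∷_) (heads-pairs y ys)

  unique⇒distinctHeads : ∀ x {xs} → Unique xs → DistinctHeads (pairs (x ∷ xs))
  unique⇒distinctHeads x {xs} u = AllPairs.map⁻ (subst Unique (sym (heads-pairs x xs)) u)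

  ∉⇒notHead : ∀ x {xs} {v : Fin n} → v ∉ xs → All (λ q → v ≢ proj₂ q) (pairs (x ∷ xs))
  ∉⇒notHead x {xs} v∉ = All.map⁻ (subst (All _) (sym (heads-pairs x xs)) (All.¬Any⇒All¬ xs v∉))

  ∈⇒predecessor : ∀ x {xs} {v : Fin n} → v ∈ xs → ∃[ u ] (u , v) ∈ pairs (x ∷ xs)
  ∈⇒predecessor x (here refl)          = x , here refl
  ∈⇒predecessor x {_ ∷ _} (there v∈)   = map₂ there (∈⇒predecessor _ v∈)

module _ {n} {T : Arcs n} (uniq : UniqueInNeighbours T) where

  changedColumn⇔ : ∀ {u v} a → (if not (T u v) then ⌊ a ≟ u ⌋ else T a v) ≡ true ⇔ a ≡ u
  changedColumn⇔ {u} {v} a with T u v in uv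
  ... | true  = mk⇔ (λ av → uniq av uv) λ { refl → uv }
  ... | false = mk⇔ ≟-true λ { refl → ≟-refl }
    where
      ≟-true : ⌊ a ≟ u ⌋ ≡ true → a ≡ u
      ≟-true e with a ≟ u
      ... | yes a≡u = a≡u

      ≟-refl : ⌊ a ≟ a ⌋ ≡ true
      ≟-refl with a ≟ a
      ... | yes _   = refl
      ... | no a≢a  = contradiction refl a≢a

module ChangesAlong {n} (T : Arcs n) (x : Fin n) (xs : List (Fin n)) (unique-xs : Unique xs) where

  T′ : Arcs n
  T′ = changesAlong T (x ∷ xs)

  missingArc : Fin n × Fin n → Bool
  missingArc (u , v) = not (T u v)

  column-offPath : ∀ {v} → v ∉ xs → ∀ a → T′ a v ≡ T a v
  column-offPath v∉ = changes-column-untouched missingArc (pairs (x ∷ xs)) T (∉⇒notHead x v∉)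

  inArc-onPath⇔ : UniqueInNeighbours T → ∀ {u v} → (u , v) ∈ pairs (x ∷ xs) →
                  ∀ a → Arc T′ a v ⇔ a ≡ u
  inArc-onPath⇔ uniq {u} {v} m a =
    subst (λ t → t ≡ true ⇔ a ≡ u)
          (sym (changes-column-head missingArc (pairs (x ∷ xs)) T (unique⇒distinctHeads x unique-xs) m a))
          (changedColumn⇔ {T = T} uniq a)

  inArc-offPath : ∀ {a v} → v ∉ xs → Arc T′ a v → Arc T a v
  inArc-offPath {a} v∉ av = trans (sym (column-offPath v∉ a)) av

  changesAlong-pathIn : UniqueInNeighbours T → PathIn (x ∷ xs) T′
  changesAlong-pathIn uniq = All.tabulate λ { {u , _} m → Equivalence.from (inArc-onPath⇔ uniq m u) refl }

  changesAlong-⊆ : ∀ E → UniqueInNeighbours T → T ⊆A E → PathIn (x ∷ xs) E → T′ ⊆A E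
  changesAlong-⊆ E uniq T⊆E xs⊆E a v av with any? (v ≟_) xs
  ... | no v∉  = T⊆E a v (inArc-offPath v∉ av)
  ... | yes v∈ with ∈⇒predecessor x v∈
  ...   | _ , m with Equivalence.to (inArc-onPath⇔ uniq m a) av
  ...     | refl = All.lookup xs⊆E m

  changesAlong-arborescence : Arborescence T x → x ∉ xs → Arborescence T′ x
  changesAlong-arborescence A x∉ = record
    { noArcIntoRoot = λ a xa → noArcIntoRoot a (inArc-offPath x∉ xa)
    ; uniqueIn      = uniq′
    ; reachable     = λ v → transfer (reachable v)
    }
    where
      open Arborescence A

      uniq′ : UniqueInNeighbours T′
      uniq′ {a} {b} {v} av bv with any? (v ≟_) xs
      ... | no v∉  = uniqueIn (inArc-offPath v∉ av) (inArc-offPath v∉ bv)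
      ... | yes v∈ with ∈⇒predecessor x v∈
      ...   | _ , m = trans (Equivalence.to (inArc-onPath⇔ uniqueIn m a) av)
                            (sym (Equivalence.to (inArc-onPath⇔ uniqueIn m b) bv))

      transfer : ∀ {v} → Reach T x v → Reach T′ x v
      transfer start = start
      transfer (_▷_ {u} {w} R uw) with any? (w ≟_) xs
      ... | no w∉  = transfer R ▷ trans (column-offPath w∉ u) uw
      ... | yes w∈ = reach-alongPath xs (changesAlong-pathIn uniqueIn) start (proj₂ (∈⇒predecessor x w∈))

mainTheorem6 : ∀ {n} (D : Digraph n) (T : Arcs n) (r : Fin n) (Q : List (Fin n)) →
    OutBranchingAt D T r → IsDipath D (r ∷ Q) →
    IsOutBranching D (changesAlong T (r ∷ Q)) × PathIn (r ∷ Q) (changesAlong T (r ∷ Q))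
mainTheorem6 D T r Q T-branching (r∉Q ∷ unique-Q , Q⊆D) =
  (r , arborescence⇒outBranchingAt T′-arborescence D T′⊆D) , changesAlong-pathIn uniqueIn
  where
    open ChangesAlong T r Q unique-Q
    T-arborescence : Arborescence T r
    T-arborescence = outBranchingAt⇒arborescence D T-branching
    open Arborescence T-arborescence using (uniqueIn)

    T′-arborescence : Arborescence T′ r
    T′-arborescence = changesAlong-arborescence T-arborescence (All.All¬⇒¬Any r∉Q)

    T′⊆D : T′ ⊆A arcs D
    T′⊆D = changesAlong-⊆ (arcs D) uniqueIn (proj₁ T-branching) Q⊆D
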